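{- Let $n,k,\ell,t$ be positive integers with $n\geq 2(k-t+1)(\ell-t+1)+t+1$, and let $\mathcal{F}\subseteq\binom{[n]}{k}$ and $\mathcal{G}\subseteq\binom{[n]}{\ell}$ be maximal cross $t$-intersecting families with $\tau_t(\mathcal{F})=m_f$ and $\tau_t(\mathcal{G})=m_g$. Then $|\mathcal{F}|\leq\binom{m_f}{t}\binom{n-t}{k-t}$. Furthermore: (i) if $m_g=t+1$, then $|\mathcal{F}|\leq(\ell-t+1)\binom{m_f}{t}\binom{n-t-1}{k-t-1}$; (ii) if $m_g\geq t+2$, then $|\mathcal{F}|\leq\ell^{m_g-t-2}(\ell-t+1)^2\binom{m_f}{t}\binom{n-m_g}{k-m_g}$.
   Context: $[n]=\{1,\dots,n\}$; $\binom{[n]}{k}$ is the family of $k$-subsets of $[n]$; $\binom{a}{b}=0$ when $b<0$ or $b>a$. Families $\mathcal{F}$, $\mathcal{G}$ are cross $t$-intersecting if $|F\cap G|\geq t$ for all $F\in\mathcal{F}$, $G\in\mathcal{G}$; the pair $\mathcal{F}\subseteq\binom{[n]}{k}$, $\mathcal{G}\subseteq\binom{[n]}{\ell}$ is maximal if no cross $t$-intersecting pair $\mathcal{F}'\supseteq\mathcal{F}$, $\mathcal{G}'\supseteq\mathcal{G}$ (of $k$- resp. $\ell$-subsets) differs from it. A $t$-cover of $\mathcal{F}$ is a set $T\subseteq[n]$ with $|T\cap F|\geq t$ for all $F\in\mathcal{F}$; $\tau_t(\mathcal{F})$ is the minimum size of a $t$-cover. -}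

module Defs where

open import Data.Nat using (ℕ; zero; suc; _≤_)
open import Data.Nat.Combinatorics using (_C_)
open import Data.Integer using (ℤ; +_; -[1+_])
open import Data.Bool using (Bool; true; false)
open import Data.List using (List; []; _∷_; _++_; map; filter; length)
open import Data.Vec using (_∷_; [])
open import Data.Fin.Subset using (Subset; ∣_∣; _∩_)
open import Relation.Binary.PropositionalEquality using (_≡_)
open import Data.Bool.Properties using (T?)

Family : ℕ → Set
Family n = Subset n → Bool

allSubsets : (n : ℕ) → List (Subset n)
allSubsets zero = [] ∷ []
allSubsets (suc n) = map (false ∷_) (allSubsets n) ++ map (true ∷_) (allSubsets n)

card : ∀ {n} → Family n → ℕ
card {n} F = length (filter (λ s → T? (F s)) (allSubsets n))

Uniform : ∀ {n} → ℕ → Family n → Set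
Uniform k F = ∀ A → F A ≡ true → ∣ A ∣ ≡ k

_⊑_ : ∀ {n} → Family n → Family n → Set
F ⊑ F′ = ∀ A → F A ≡ true → F′ A ≡ true

CrossInt : ∀ {n} → ℕ → Family n → Family n → Set
CrossInt t F G = ∀ A B → F A ≡ true → G B ≡ true → t ≤ ∣ A ∩ B ∣

MaximalCrossInt : ∀ {n} → ℕ → ℕ → ℕ → Family n → Family n → Set
MaximalCrossInt {n} k ℓ t F G =
  Uniform k F × Uniform ℓ G × CrossInt t F G ×
  (∀ (F′ G′ : Family n) → Uniform k F′ → Uniform ℓ G′ → CrossInt t F′ G′ →
     F ⊑ F′ → G ⊑ G′ → (∀ A → F′ A ≡ F A) × (∀ B → G′ B ≡ G B))
  where open import Data.Product using (_×_)

IsTCover : ∀ {n} → ℕ → Family n → Subset n → Set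
IsTCover t F T = ∀ A → F A ≡ true → t ≤ ∣ T ∩ A ∣

TauT≡ : ∀ {n} → ℕ → Family n → ℕ → Set
TauT≡ {n} t F m = Σ (Subset n) (λ T → IsTCover t F T × ∣ T ∣ ≡ m)
                × (∀ T → IsTCover t F T → m ≤ ∣ T ∣)
  where open import Data.Product using (Σ; _×_)

-- Binomial coefficient with integer arguments: binom a b = 0 if b < 0 or b > a.
binom : ℤ → ℤ → ℕ
binom (+ a) (+ b) = a C b
binom (+ a) -[1+ _ ] = 0
binom -[1+ _ ] _ = 0

-- Write deg S for the number of members of F containing S. If T is a t-cover of F, every
-- member of F through S ⊆ T (with |S| = t - r) contains r further points of T ∖ S, so double
-- counting the incidences with T ∖ S gives r · deg S ≤ |T ∖ S| · max deg (S ∪ {x}); by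
-- induction |F| = deg ∅ ≤ C(|T|, t) · max {deg S : S ⊆ T, |S| = t}. If |S| < τ_t(G), then S
-- is not a t-cover of G: some B ∈ G meets S in j < t points, every member of F through S
-- meets B ∖ S in at least t - j points, and |B ∖ S| = ℓ - j ≤ (t - j)(ℓ - t + 1), so
-- deg S ≤ (ℓ - t + 1) · max deg (S ∪ {x}). Growing S from size t to size m_g, where
-- deg S ≤ C(n - m_g, k - m_g), yields |F| ≤ C(m_f, t) (ℓ - t + 1)^(m_g - t) C(n - m_g, k - m_g),
-- and (i), (ii) follow from ℓ - t + 1 ≤ ℓ.
module Submission where

open import Defs

module Counting where

  open import Data.Nat.Properties
  open import Algebra.Properties.CommutativeSemigroup +-commutativeSemigroup
    using () renaming (interchange to +-interchange)
  open import Algebra.Properties.Semiring.Sum +-*-semiring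
    using (sum; sum-syntax; sum-cong-≗; *-distribˡ-sum; *-distribʳ-sum)
  open import Data.Bool.Base using (true; false; if_then_else_)
  import Data.Bool.Properties as Bool
  open import Data.Empty using (⊥-elim)
  open import Data.Fin.Base using (Fin; zero; suc)
  open import Data.Fin.Subset
    using (Subset; inside; outside; ⊤; ⁅_⁆; _∈_; _∉_; _⊆_; _∩_; _∪_; _─_; ∣_∣)
    renaming (⊥ to ∅)
  open import Data.Fin.Subset.Properties
    using ( _∈?_; _⊆?_; anySubset?; ∩⇔×; x∈p∩q⁺; x∈p∪q⁻; x∈⁅y⁆⇒x≡y; drop-∷-⊆; p─q⊆p
          ; ⊥⊆; ⊆⊤; ∣⊥∣≡0; ∣⊤∣≡n; ∣p∣≤n; ∩-comm; ∩-identityˡ; ∪-identityʳ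
          ; p⊆q⇒∣p∣≤∣q∣; ∣p∩q∣≤∣p∣; ∣p∩q∣≤∣q∣ )
  open import Data.List.Base using (List; []; _∷_; _++_; map; filter; length)
  open import Data.List.Properties using (map-++; map-∘)
  open import Data.Nat.Base
  open import Data.Nat.Combinatorics using (_C_; nC1≡n; nCk+nC[k+1]≡[n+1]C[k+1])
  open import Data.Nat.ListAction using () renaming (sum to sumˡ)
  open import Data.Nat.ListAction.Properties using () renaming (sum-++ to sumˡ-++)
  open import Data.Product.Base using (_×_; _,_; proj₁; ∃-syntax)
  open import Data.Sum.Base using (inj₁; inj₂)
  open import Data.Vec.Base using ([]; _∷_; here; there)
  open import Data.Vec.Properties using (∷-injectiveʳ)
  open import Function.Base using (_∘_; case_of_)
  open import Function.Bundles using (_⇔_; Equivalence; mk⇔)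
  open import Relation.Binary.PropositionalEquality
  open import Relation.Nullary.Decidable using (Dec; yes; no; does; _×-dec_)
  open import Relation.Nullary.Negation using (¬_; contradiction)
  open import Relation.Unary using (Pred; Decidable)

  indicator : ∀ {a} {A : Set a} → Dec A → ℕ
  indicator a? = if does a? then 1 else 0

  module _ {a b} {A : Set a} {B : Set b} where

    indicator-mono : (A → B) → (a? : Dec A) (b? : Dec B) → indicator a? ≤ indicator b?
    indicator-mono A→B (yes a) (yes _) = ≤-refl
    indicator-mono A→B (yes a) (no ¬b) = ⊥-elim (¬b (A→B a))
    indicator-mono A→B (no _)  _       = z≤n

    indicator-×-dec : (a? : Dec A) (b? : Dec B) → indicator (a? ×-dec b?) ≡ indicator a? * indicator b?
    indicator-×-dec (yes _) (yes _) = refl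
    indicator-×-dec (yes _) (no _)  = refl
    indicator-×-dec (no _)  _       = refl

  indicator-cong : ∀ {a b} {A : Set a} {B : Set b} →
                   A ⇔ B → (a? : Dec A) (b? : Dec B) → indicator a? ≡ indicator b?
  indicator-cong A⇔B a? b? = ≤-antisym (indicator-mono to a? b?) (indicator-mono from b? a?)
    where open Equivalence A⇔B

  indicator-no : ∀ {a} {A : Set a} → ¬ A → (a? : Dec A) → indicator a? ≡ 0
  indicator-no ¬a (yes a) = contradiction a ¬a
  indicator-no ¬a (no _)  = refl

  indicator≤1 : ∀ {a} {A : Set a} (a? : Dec A) → indicator a? ≤ 1
  indicator≤1 (yes _) = ≤-refl
  indicator≤1 (no _)  = z≤n

  ∑ₛ : ∀ {n} → (Subset n → ℕ) → ℕ
  ∑ₛ {zero}  w = w []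
  ∑ₛ {suc n} w = ∑ₛ (w ∘ (outside ∷_)) + ∑ₛ (w ∘ (inside ∷_))

  ∑ₛ-cong : ∀ {n} {w v : Subset n → ℕ} → (∀ A → w A ≡ v A) → ∑ₛ w ≡ ∑ₛ v
  ∑ₛ-cong {zero}  w≗v = w≗v []
  ∑ₛ-cong {suc n} w≗v = cong₂ _+_ (∑ₛ-cong (w≗v ∘ (outside ∷_))) (∑ₛ-cong (w≗v ∘ (inside ∷_)))

  ∑ₛ-mono-≤ : ∀ {n} {w v : Subset n → ℕ} → (∀ A → w A ≤ v A) → ∑ₛ w ≤ ∑ₛ v
  ∑ₛ-mono-≤ {zero}  w≤v = w≤v []
  ∑ₛ-mono-≤ {suc n} w≤v = +-mono-≤ (∑ₛ-mono-≤ (w≤v ∘ (outside ∷_))) (∑ₛ-mono-≤ (w≤v ∘ (inside ∷_)))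

  ∑ₛ-zero : ∀ n → ∑ₛ {n} (λ _ → 0) ≡ 0
  ∑ₛ-zero zero    = refl
  ∑ₛ-zero (suc n) = cong₂ _+_ (∑ₛ-zero n) (∑ₛ-zero n)

  ∑ₛ-distrib-+ : ∀ {n} (w v : Subset n → ℕ) → ∑ₛ (λ A → w A + v A) ≡ ∑ₛ w + ∑ₛ v
  ∑ₛ-distrib-+ {zero}  w v = refl
  ∑ₛ-distrib-+ {suc n} w v =
    trans (cong₂ _+_ (∑ₛ-distrib-+ w₀ v₀) (∑ₛ-distrib-+ w₁ v₁))
          (+-interchange (∑ₛ w₀) (∑ₛ v₀) (∑ₛ w₁) (∑ₛ v₁))
    where
    w₀ = w ∘ (outside ∷_)
    v₀ = v ∘ (outside ∷_)
    w₁ = w ∘ (inside ∷_)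
    v₁ = v ∘ (inside ∷_)

  *-distribˡ-∑ₛ : ∀ {n} c (w : Subset n → ℕ) → c * ∑ₛ w ≡ ∑ₛ (λ A → c * w A)
  *-distribˡ-∑ₛ {zero}  c w = refl
  *-distribˡ-∑ₛ {suc n} c w = trans (*-distribˡ-+ c _ _)
    (cong₂ _+_ (*-distribˡ-∑ₛ c (w ∘ (outside ∷_))) (*-distribˡ-∑ₛ c (w ∘ (inside ∷_))))

  ∑ₛ-∑-comm : ∀ {n} m (f : Fin m → Subset n → ℕ) → ∑ₛ (λ A → ∑[ x < m ] f x A) ≡ ∑[ x < m ] ∑ₛ (f x)
  ∑ₛ-∑-comm {n} zero    f = ∑ₛ-zero n
  ∑ₛ-∑-comm     (suc m) f = trans (∑ₛ-distrib-+ (f zero) (λ A → ∑[ x < m ] f (suc x) A))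
                                   (cong (∑ₛ (f zero) +_) (∑ₛ-∑-comm m (f ∘ suc)))

  sum-mono-≤ : ∀ {m} {f g : Fin m → ℕ} → (∀ x → f x ≤ g x) → sum f ≤ sum g
  sum-mono-≤ {zero}  f≤g = z≤n
  sum-mono-≤ {suc m} f≤g = +-mono-≤ (f≤g zero) (sum-mono-≤ (f≤g ∘ suc))

  sumˡ-map-allSubsets : ∀ n (w : Subset n → ℕ) → sumˡ (map w (allSubsets n)) ≡ ∑ₛ w
  sumˡ-map-allSubsets zero    w = +-identityʳ (w [])
  sumˡ-map-allSubsets (suc n) w = begin
    sumˡ (map w (map (outside ∷_) As ++ map (inside ∷_) As))
      ≡⟨ cong sumˡ (map-++ w (map (outside ∷_) As) (map (inside ∷_) As)) ⟩
    sumˡ (map w (map (outside ∷_) As) ++ map w (map (inside ∷_) As))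
      ≡⟨ sumˡ-++ (map w (map (outside ∷_) As)) (map w (map (inside ∷_) As)) ⟩
    sumˡ (map w (map (outside ∷_) As)) + sumˡ (map w (map (inside ∷_) As))
      ≡⟨ cong₂ (λ xs ys → sumˡ xs + sumˡ ys) (map-∘ As) (map-∘ As) ⟨
    sumˡ (map (w ∘ (outside ∷_)) As) + sumˡ (map (w ∘ (inside ∷_)) As)
      ≡⟨ cong₂ _+_ (sumˡ-map-allSubsets n (w ∘ (outside ∷_))) (sumˡ-map-allSubsets n (w ∘ (inside ∷_))) ⟩
    ∑ₛ w ∎
    where
    open ≡-Reasoning
    As = allSubsets n

  count : ∀ {n p} {P : Pred (Subset n) p} → Decidable P → ℕ
  count P? = ∑ₛ (indicator ∘ P?)

  module _ {n p q} {P : Pred (Subset n) p} {Q : Pred (Subset n) q}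
           (P? : Decidable P) (Q? : Decidable Q) where

    count-mono : (∀ {A} → P A → Q A) → count P? ≤ count Q?
    count-mono P⊆Q = ∑ₛ-mono-≤ λ A → indicator-mono P⊆Q (P? A) (Q? A)

    count-cong : (∀ {A} → P A ⇔ Q A) → count P? ≡ count Q?
    count-cong P⇔Q = ∑ₛ-cong λ A → indicator-cong P⇔Q (P? A) (Q? A)

  count-none : ∀ {n p} {P : Pred (Subset n) p} (P? : Decidable P) → (∀ A → ¬ P A) → count P? ≡ 0
  count-none {n} P? ¬P = trans (∑ₛ-cong λ A → indicator-no (¬P A) (P? A)) (∑ₛ-zero n)

  count-unique≤1 : ∀ {n p} {P : Pred (Subset n) p} (P? : Decidable P) →
                   (∀ {A B} → P A → P B → A ≡ B) → count P? ≤ 1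
  count-unique≤1 {zero}  P? _      = indicator≤1 (P? [])
  count-unique≤1 {suc n} P? unique with anySubset? (P? ∘ (outside ∷_))
  ... | yes (A , PA) = begin
    count (P? ∘ (outside ∷_)) + count (P? ∘ (inside ∷_))
      ≡⟨ cong (count (P? ∘ (outside ∷_)) +_)
              (count-none (P? ∘ (inside ∷_)) λ B PB → case unique PA PB of λ ()) ⟩
    count (P? ∘ (outside ∷_)) + 0
      ≡⟨ +-identityʳ _ ⟩
    count (P? ∘ (outside ∷_))
      ≤⟨ count-unique≤1 (P? ∘ (outside ∷_)) (λ PB PC → ∷-injectiveʳ (unique PB PC)) ⟩
    1 ∎
    where open ≤-Reasoning
  ... | no ∄A = begin
    count (P? ∘ (outside ∷_)) + count (P? ∘ (inside ∷_))
      ≡⟨ cong (_+ count (P? ∘ (inside ∷_))) (count-none (P? ∘ (outside ∷_)) λ A PA → ∄A (A , PA)) ⟩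
    count (P? ∘ (inside ∷_))
      ≤⟨ count-unique≤1 (P? ∘ (inside ∷_)) (λ PB PC → ∷-injectiveʳ (unique PB PC)) ⟩
    1 ∎
    where open ≤-Reasoning

  ∣p∣≡∑ : ∀ {n} (p : Subset n) → ∣ p ∣ ≡ ∑[ x < n ] indicator (x ∈? p)
  ∣p∣≡∑ []            = refl
  ∣p∣≡∑ (inside  ∷ p) = cong suc (∣p∣≡∑ p)
  ∣p∣≡∑ (outside ∷ p) = ∣p∣≡∑ p

  ∣p∩q∣≡∑ : ∀ {n} (p q : Subset n) → ∣ p ∩ q ∣ ≡ ∑[ x < n ] (indicator (x ∈? p) * indicator (x ∈? q))
  ∣p∩q∣≡∑ p q = trans (∣p∣≡∑ (p ∩ q)) (sum-cong-≗ λ x →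
    trans (indicator-cong ∩⇔× (x ∈? p ∩ q) (x ∈? p ×-dec x ∈? q)) (indicator-×-dec (x ∈? p) (x ∈? q)))

  double-count : ∀ {n p} {P : Pred (Subset n) p} (P? : Decidable P) (X : Subset n) {d Y : ℕ} →
                 (∀ {A} → P A → d ≤ ∣ A ∩ X ∣) →
                 (∀ {x} → x ∈ X → count (λ A → P? A ×-dec x ∈? A) ≤ Y) →
                 d * count P? ≤ ∣ X ∣ * Y
  double-count {n} P? X {d} {Y} meets-X through-x = begin
    d * count P?
      ≡⟨ *-distribˡ-∑ₛ d (indicator ∘ P?) ⟩
    ∑ₛ (λ A → d * χ A)
      ≤⟨ ∑ₛ-mono-≤ weigh ⟩
    ∑ₛ (λ A → χ A * ∣ A ∩ X ∣)
      ≡⟨ ∑ₛ-cong (λ A → cong (χ A *_) (∣p∩q∣≡∑ A X)) ⟩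
    ∑ₛ (λ A → χ A * ∑[ x < n ] (χ[ x ∈ A ] * χ[ x ∈ X ]))
      ≡⟨ ∑ₛ-cong (λ A → *-distribˡ-sum (χ A) (λ x → χ[ x ∈ A ] * χ[ x ∈ X ])) ⟩
    ∑ₛ (λ A → ∑[ x < n ] (χ A * (χ[ x ∈ A ] * χ[ x ∈ X ])))
      ≡⟨ ∑ₛ-∑-comm n (λ x A → χ A * (χ[ x ∈ A ] * χ[ x ∈ X ])) ⟩
    ∑[ x < n ] ∑ₛ (λ A → χ A * (χ[ x ∈ A ] * χ[ x ∈ X ]))
      ≡⟨ sum-cong-≗ (λ x → trans (∑ₛ-cong (regroup x))
           (sym (*-distribˡ-∑ₛ χ[ x ∈ X ] (λ A → indicator (P? A ×-dec x ∈? A))))) ⟩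
    ∑[ x < n ] (χ[ x ∈ X ] * count (λ A → P? A ×-dec x ∈? A))
      ≤⟨ sum-mono-≤ bound ⟩
    ∑[ x < n ] (χ[ x ∈ X ] * Y)
      ≡⟨ *-distribʳ-sum Y (λ x → χ[ x ∈ X ]) ⟨
    ∑[ x < n ] χ[ x ∈ X ] * Y
      ≡⟨ cong (_* Y) (∣p∣≡∑ X) ⟨
    ∣ X ∣ * Y ∎
    where
    open ≤-Reasoning
    χ : Subset n → ℕ
    χ A = indicator (P? A)
    χ[_∈_] : Fin n → Subset n → ℕ
    χ[ x ∈ A ] = indicator (x ∈? A)

    weigh : ∀ A → d * χ A ≤ χ A * ∣ A ∩ X ∣
    weigh A with P? A
    ... | yes PA = subst₂ _≤_ (sym (*-identityʳ d)) (sym (+-identityʳ _)) (meets-X PA)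
    ... | no  _  = ≤-reflexive (*-zeroʳ d)

    regroup : ∀ x A → χ A * (χ[ x ∈ A ] * χ[ x ∈ X ]) ≡ χ[ x ∈ X ] * indicator (P? A ×-dec x ∈? A)
    regroup x A = begin-equality
      χ A * (χ[ x ∈ A ] * χ[ x ∈ X ])
        ≡⟨ *-assoc (χ A) χ[ x ∈ A ] χ[ x ∈ X ] ⟨
      χ A * χ[ x ∈ A ] * χ[ x ∈ X ]
        ≡⟨ *-comm (χ A * χ[ x ∈ A ]) χ[ x ∈ X ] ⟩
      χ[ x ∈ X ] * (χ A * χ[ x ∈ A ])
        ≡⟨ cong (χ[ x ∈ X ] *_) (indicator-×-dec (P? A) (x ∈? A)) ⟨
      χ[ x ∈ X ] * indicator (P? A ×-dec x ∈? A) ∎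

    bound : ∀ x → χ[ x ∈ X ] * count (λ A → P? A ×-dec x ∈? A) ≤ χ[ x ∈ X ] * Y
    bound x with x ∈? X
    ... | yes x∈X = *-monoʳ-≤ 1 (through-x x∈X)
    ... | no  _   = z≤n

  module _ {n} (F : Family n) where

    member? : Decidable (λ A → F A ≡ true)
    member? A = F A Bool.≟ true

    length-filter≡sumˡ : (As : List (Subset n)) →
                         length (filter (λ A → Bool.T? (F A)) As) ≡ sumˡ (map (indicator ∘ member?) As)
    length-filter≡sumˡ []       = refl
    length-filter≡sumˡ (A ∷ As) with F A
    ... | true  = cong suc (length-filter≡sumˡ As)
    ... | false = length-filter≡sumˡ As

    card≡count : card F ≡ count member?
    card≡count = trans (length-filter≡sumˡ (allSubsets n)) (sumˡ-map-allSubsets n (indicator ∘ member?))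

  ∣p∩q∣≤∣r∩q∣+∣p∩[q─r]∣ : ∀ {n} (p q r : Subset n) → ∣ p ∩ q ∣ ≤ ∣ r ∩ q ∣ + ∣ p ∩ (q ─ r) ∣
  ∣p∩q∣≤∣r∩q∣+∣p∩[q─r]∣ []            []            []            = z≤n
  ∣p∩q∣≤∣r∩q∣+∣p∩[q─r]∣ (inside  ∷ p) (inside  ∷ q) (inside  ∷ r) = s≤s (∣p∩q∣≤∣r∩q∣+∣p∩[q─r]∣ p q r)
  ∣p∩q∣≤∣r∩q∣+∣p∩[q─r]∣ (inside  ∷ p) (inside  ∷ q) (outside ∷ r) =
    subst (suc ∣ p ∩ q ∣ ≤_) (sym (+-suc ∣ r ∩ q ∣ _)) (s≤s (∣p∩q∣≤∣r∩q∣+∣p∩[q─r]∣ p q r))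
  ∣p∩q∣≤∣r∩q∣+∣p∩[q─r]∣ (outside ∷ p) (inside  ∷ q) (inside  ∷ r) =
    m≤n⇒m≤1+n (∣p∩q∣≤∣r∩q∣+∣p∩[q─r]∣ p q r)
  ∣p∩q∣≤∣r∩q∣+∣p∩[q─r]∣ (outside ∷ p) (inside  ∷ q) (outside ∷ r) = ∣p∩q∣≤∣r∩q∣+∣p∩[q─r]∣ p q r
  ∣p∩q∣≤∣r∩q∣+∣p∩[q─r]∣ (inside  ∷ p) (outside ∷ q) (inside  ∷ r) = ∣p∩q∣≤∣r∩q∣+∣p∩[q─r]∣ p q r
  ∣p∩q∣≤∣r∩q∣+∣p∩[q─r]∣ (inside  ∷ p) (outside ∷ q) (outside ∷ r) = ∣p∩q∣≤∣r∩q∣+∣p∩[q─r]∣ p q r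
  ∣p∩q∣≤∣r∩q∣+∣p∩[q─r]∣ (outside ∷ p) (outside ∷ q) (inside  ∷ r) = ∣p∩q∣≤∣r∩q∣+∣p∩[q─r]∣ p q r
  ∣p∩q∣≤∣r∩q∣+∣p∩[q─r]∣ (outside ∷ p) (outside ∷ q) (outside ∷ r) = ∣p∩q∣≤∣r∩q∣+∣p∩[q─r]∣ p q r

  ∣p─q∣+∣q∩p∣≡∣p∣ : ∀ {n} (p q : Subset n) → ∣ p ─ q ∣ + ∣ q ∩ p ∣ ≡ ∣ p ∣
  ∣p─q∣+∣q∩p∣≡∣p∣ []            []            = refl
  ∣p─q∣+∣q∩p∣≡∣p∣ (inside  ∷ p) (inside  ∷ q) =
    trans (+-suc ∣ p ─ q ∣ _) (cong suc (∣p─q∣+∣q∩p∣≡∣p∣ p q))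
  ∣p─q∣+∣q∩p∣≡∣p∣ (inside  ∷ p) (outside ∷ q) = cong suc (∣p─q∣+∣q∩p∣≡∣p∣ p q)
  ∣p─q∣+∣q∩p∣≡∣p∣ (outside ∷ p) (inside  ∷ q) = ∣p─q∣+∣q∩p∣≡∣p∣ p q
  ∣p─q∣+∣q∩p∣≡∣p∣ (outside ∷ p) (outside ∷ q) = ∣p─q∣+∣q∩p∣≡∣p∣ p q

  ∣p─q∣≡∣p∣∸∣q∩p∣ : ∀ {n} (p q : Subset n) → ∣ p ─ q ∣ ≡ ∣ p ∣ ∸ ∣ q ∩ p ∣
  ∣p─q∣≡∣p∣∸∣q∩p∣ p q =
    trans (sym (m+n∸n≡m ∣ p ─ q ∣ ∣ q ∩ p ∣)) (cong (_∸ ∣ q ∩ p ∣) (∣p─q∣+∣q∩p∣≡∣p∣ p q))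

  p⊆q⇒∣p∩q∣≡∣p∣ : ∀ {n} {p q : Subset n} → p ⊆ q → ∣ p ∩ q ∣ ≡ ∣ p ∣
  p⊆q⇒∣p∩q∣≡∣p∣ {p = p} {q} p⊆q =
    ≤-antisym (∣p∩q∣≤∣p∣ p q) (p⊆q⇒∣p∣≤∣q∣ λ x∈p → x∈p∩q⁺ (x∈p , p⊆q x∈p))

  q⊆p⇒∣p─q∣≡∣p∣∸∣q∣ : ∀ {n} {p q : Subset n} → q ⊆ p → ∣ p ─ q ∣ ≡ ∣ p ∣ ∸ ∣ q ∣
  q⊆p⇒∣p─q∣≡∣p∣∸∣q∣ {p = p} {q} q⊆p =
    trans (∣p─q∣≡∣p∣∸∣q∩p∣ p q) (cong (∣ p ∣ ∸_) (p⊆q⇒∣p∩q∣≡∣p∣ q⊆p))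

  p⊆q⇒∣q∣≤∣p∣⇒p≡q : ∀ {n} {p q : Subset n} → p ⊆ q → ∣ q ∣ ≤ ∣ p ∣ → p ≡ q
  p⊆q⇒∣q∣≤∣p∣⇒p≡q {p = []}          {[]}          _   _   = refl
  p⊆q⇒∣q∣≤∣p∣⇒p≡q {p = inside  ∷ p} {outside ∷ q} p⊆q _   = contradiction (p⊆q here) λ ()
  p⊆q⇒∣q∣≤∣p∣⇒p≡q {p = outside ∷ p} {inside  ∷ q} p⊆q q≤p =
    contradiction (≤-trans q≤p (p⊆q⇒∣p∣≤∣q∣ (drop-∷-⊆ p⊆q))) (n≮n _)
  p⊆q⇒∣q∣≤∣p∣⇒p≡q {p = inside  ∷ p} {inside  ∷ q} p⊆q q≤p =
    cong (inside ∷_) (p⊆q⇒∣q∣≤∣p∣⇒p≡q (drop-∷-⊆ p⊆q) (s≤s⁻¹ q≤p))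
  p⊆q⇒∣q∣≤∣p∣⇒p≡q {p = outside ∷ p} {outside ∷ q} p⊆q q≤p =
    cong (outside ∷_) (p⊆q⇒∣q∣≤∣p∣⇒p≡q (drop-∷-⊆ p⊆q) q≤p)

  x∈p─q⇒x∉q : ∀ {n} {x : Fin n} (p q : Subset n) → x ∈ p ─ q → x ∉ q
  x∈p─q⇒x∉q            (inside  ∷ p) (outside ∷ q) here       = λ ()
  x∈p─q⇒x∉q {x = zero} (outside ∷ p) (outside ∷ q) ()
  x∈p─q⇒x∉q {x = zero} (outside ∷ p) (inside  ∷ q) ()
  x∈p─q⇒x∉q            (_       ∷ p) (_       ∷ q) (there x∈) = λ { (there x∈q) → x∈p─q⇒x∉q p q x∈ x∈q }

  x∉p⇒∣p∪⁅x⁆∣≡1+∣p∣ : ∀ {n} (p : Subset n) (x : Fin n) → x ∉ p → ∣ p ∪ ⁅ x ⁆ ∣ ≡ suc ∣ p ∣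
  x∉p⇒∣p∪⁅x⁆∣≡1+∣p∣ (inside  ∷ p) zero    x∉p = contradiction here x∉p
  x∉p⇒∣p∪⁅x⁆∣≡1+∣p∣ (outside ∷ p) zero    _   = cong (suc ∘ ∣_∣) (∪-identityʳ p)
  x∉p⇒∣p∪⁅x⁆∣≡1+∣p∣ (inside  ∷ p) (suc x) x∉p = cong suc (x∉p⇒∣p∪⁅x⁆∣≡1+∣p∣ p x (x∉p ∘ there))
  x∉p⇒∣p∪⁅x⁆∣≡1+∣p∣ (outside ∷ p) (suc x) x∉p = x∉p⇒∣p∪⁅x⁆∣≡1+∣p∣ p x (x∉p ∘ there)

  p⊆q⇒x∈q⇒p∪⁅x⁆⊆q : ∀ {n} {p q : Subset n} {x} → p ⊆ q → x ∈ q → p ∪ ⁅ x ⁆ ⊆ q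
  p⊆q⇒x∈q⇒p∪⁅x⁆⊆q {p = p} {x = x} p⊆q x∈q y∈ with x∈p∪q⁻ p ⁅ x ⁆ y∈
  ... | inj₁ y∈p   = p⊆q y∈p
  ... | inj₂ y∈⁅x⁆ rewrite x∈⁅y⁆⇒x≡y x y∈⁅x⁆ = x∈q

  [1+k]*nC[1+k]≡n*[n∸1]Ck : ∀ n k → suc k * (n C suc k) ≡ n * (pred n C k)
  [1+k]*nC[1+k]≡n*[n∸1]Ck zero          k       = *-zeroʳ (suc k)
  [1+k]*nC[1+k]≡n*[n∸1]Ck (suc zero)    zero    = refl
  [1+k]*nC[1+k]≡n*[n∸1]Ck (suc zero)    (suc k) = *-zeroʳ (suc (suc k))
  [1+k]*nC[1+k]≡n*[n∸1]Ck (suc (suc m)) zero    =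
    trans (*-identityˡ _) (trans (nC1≡n (suc (suc m))) (sym (*-identityʳ (suc (suc m)))))
  [1+k]*nC[1+k]≡n*[n∸1]Ck (suc (suc m)) (suc k) = begin
    suc (suc k) * (suc (suc m) C suc (suc k))
      ≡⟨ cong (suc (suc k) *_) (nCk+nC[k+1]≡[n+1]C[k+1] (suc m) (suc k)) ⟨
    suc (suc k) * (a + b)
      ≡⟨ *-distribˡ-+ (suc (suc k)) a b ⟩
    (a + suc k * a) + suc (suc k) * b
      ≡⟨ cong₂ (λ u v → (a + u) + v) ([1+k]*nC[1+k]≡n*[n∸1]Ck (suc m) k)
                                     ([1+k]*nC[1+k]≡n*[n∸1]Ck (suc m) (suc k)) ⟩
    (a + suc m * (m C k)) + suc m * (m C suc k)
      ≡⟨ +-assoc a _ _ ⟩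
    a + (suc m * (m C k) + suc m * (m C suc k))
      ≡⟨ cong (a +_) (*-distribˡ-+ (suc m) (m C k) (m C suc k)) ⟨
    a + suc m * (m C k + m C suc k)
      ≡⟨ cong (λ c → a + suc m * c) (nCk+nC[k+1]≡[n+1]C[k+1] m k) ⟩
    suc (suc m) * a ∎
    where
    open ≡-Reasoning
    a = suc m C suc k
    b = suc m C suc (suc k)

  ℓ∸j≤[t∸j]*[1+ℓ∸t] : ∀ ℓ {j t} → j < t → ℓ ∸ j ≤ (t ∸ j) * suc (ℓ ∸ t)
  ℓ∸j≤[t∸j]*[1+ℓ∸t] ℓ {j} {t} j<t = begin
    ℓ ∸ j                        ≤⟨ ∸-monoˡ-≤ j (m≤n+m∸n ℓ t) ⟩
    (t + (ℓ ∸ t)) ∸ j            ≡⟨ +-∸-comm (ℓ ∸ t) (<⇒≤ j<t) ⟩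
    (t ∸ j) + (ℓ ∸ t)            ≤⟨ +-monoʳ-≤ (t ∸ j) (m≤n*m (ℓ ∸ t) (t ∸ j)) ⟩
    (t ∸ j) + (t ∸ j) * (ℓ ∸ t)  ≡⟨ *-suc (t ∸ j) (ℓ ∸ t) ⟨
    (t ∸ j) * suc (ℓ ∸ t)        ∎
    where
    open ≤-Reasoning
    instance _ = >-nonZero (m<n⇒0<n∸m j<t)

  c*[a*w]≡a*c*w : ∀ a c w → c * (a * w) ≡ a * c * w
  c*[a*w]≡a*c*w a c w = trans (sym (*-assoc c a w)) (cong (_* w) (*-comm c a))

  degree : ∀ {n} → Family n → Subset n → ℕ
  degree F S = count (λ A → member? F A ×-dec S ⊆? A)

  module _ {n} (F : Family n) where

    count≡degree-∅ : count (member? F) ≡ degree F ∅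
    count≡degree-∅ = count-cong (member? F) (λ A → member? F A ×-dec ∅ ⊆? A)
      (mk⇔ (λ A∈F → A∈F , λ {x} → ⊥⊆ {x = x}) proj₁)

    degree-branch : (S B : Subset n) {d Y : ℕ} →
                    (∀ {A} → F A ≡ true → S ⊆ A → ∣ S ∩ B ∣ + d ≤ ∣ A ∩ B ∣) →
                    (∀ {x} → x ∈ B → x ∉ S → degree F (S ∪ ⁅ x ⁆) ≤ Y) →
                    d * degree F S ≤ ∣ B ─ S ∣ * Y
    degree-branch S B {d} {Y} meets grows =
      double-count (λ A → member? F A ×-dec S ⊆? A) (B ─ S) meets-B─S through
      where
      meets-B─S : ∀ {A} → F A ≡ true × S ⊆ A → d ≤ ∣ A ∩ (B ─ S) ∣
      meets-B─S {A} (A∈F , S⊆A) =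
        +-cancelˡ-≤ ∣ S ∩ B ∣ d _ (≤-trans (meets A∈F S⊆A) (∣p∩q∣≤∣r∩q∣+∣p∩[q─r]∣ A B S))

      through : ∀ {x} → x ∈ B ─ S → count (λ A → (member? F A ×-dec S ⊆? A) ×-dec x ∈? A) ≤ Y
      through {x} x∈B─S = ≤-trans
        (count-mono (λ A → (member? F A ×-dec S ⊆? A) ×-dec x ∈? A)
                    (λ A → member? F A ×-dec (S ∪ ⁅ x ⁆) ⊆? A)
                    λ ((A∈F , S⊆A) , x∈A) → A∈F , p⊆q⇒x∈q⇒p∪⁅x⁆⊆q S⊆A x∈A)
        (grows (p─q⊆p B S x∈B─S) (x∈p─q⇒x∉q B S x∈B─S))

  module _ {n t Y} {F : Family n} {T : Subset n} (cover : IsTCover t F T)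
           (base : ∀ {S} → S ⊆ T → ∣ S ∣ ≡ t → degree F S ≤ Y) where

    degree-≤-cover : ∀ r {S} → S ⊆ T → ∣ S ∣ + r ≡ t → degree F S ≤ ((∣ T ∣ ∸ ∣ S ∣) C r) * Y
    degree-≤-cover zero {S} S⊆T ∣S∣+0≡t =
      subst (degree F S ≤_) (sym (*-identityˡ Y)) (base S⊆T (trans (sym (+-identityʳ ∣ S ∣)) ∣S∣+0≡t))
    degree-≤-cover (suc r) {S} S⊆T ∣S∣+1+r≡t = *-cancelˡ-≤ (suc r) (begin
      suc r * degree F S                            ≤⟨ degree-branch F S T meets grows ⟩
      ∣ T ─ S ∣ * (((∣ T ∣ ∸ suc ∣ S ∣) C r) * Y)   ≡⟨ cong₂ (λ a b → a * ((b C r) * Y))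
                                                             (q⊆p⇒∣p─q∣≡∣p∣∸∣q∣ S⊆T)
                                                             (sym (pred[m∸n]≡m∸[1+n] ∣ T ∣ ∣ S ∣)) ⟩
      p * ((pred p C r) * Y)                        ≡⟨ *-assoc p (pred p C r) Y ⟨
      p * (pred p C r) * Y                          ≡⟨ cong (_* Y) ([1+k]*nC[1+k]≡n*[n∸1]Ck p r) ⟨
      suc r * (p C suc r) * Y                       ≡⟨ *-assoc (suc r) (p C suc r) Y ⟩
      suc r * ((p C suc r) * Y)                     ∎)
      where
      open ≤-Reasoning
      p = ∣ T ∣ ∸ ∣ S ∣

      meets : ∀ {A} → F A ≡ true → S ⊆ A → ∣ S ∩ T ∣ + suc r ≤ ∣ A ∩ T ∣
      meets {A} A∈F _ = begin
        ∣ S ∩ T ∣ + suc r  ≡⟨ cong (_+ suc r) (p⊆q⇒∣p∩q∣≡∣p∣ S⊆T) ⟩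
        ∣ S ∣ + suc r      ≡⟨ ∣S∣+1+r≡t ⟩
        t                  ≤⟨ cover A A∈F ⟩
        ∣ T ∩ A ∣          ≡⟨ cong ∣_∣ (∩-comm T A) ⟩
        ∣ A ∩ T ∣          ∎

      grows : ∀ {x} → x ∈ T → x ∉ S → degree F (S ∪ ⁅ x ⁆) ≤ ((∣ T ∣ ∸ suc ∣ S ∣) C r) * Y
      grows {x} x∈T x∉S = subst (λ s → degree F (S ∪ ⁅ x ⁆) ≤ ((∣ T ∣ ∸ s) C r) * Y) ∣S∪⁅x⁆∣≡1+∣S∣
        (degree-≤-cover r (p⊆q⇒x∈q⇒p∪⁅x⁆⊆q S⊆T x∈T)
          (trans (cong (_+ r) ∣S∪⁅x⁆∣≡1+∣S∣) (trans (sym (+-suc ∣ S ∣ r)) ∣S∣+1+r≡t)))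
        where ∣S∪⁅x⁆∣≡1+∣S∣ = x∉p⇒∣p∪⁅x⁆∣≡1+∣p∣ S x x∉S

    card-≤-cover : card F ≤ (∣ T ∣ C t) * Y
    card-≤-cover = begin
      card F                         ≡⟨ card≡count F ⟩
      count (member? F)              ≡⟨ count≡degree-∅ F ⟩
      degree F ∅                     ≤⟨ degree-≤-cover t ⊥⊆ (cong (_+ t) (∣⊥∣≡0 n)) ⟩
      ((∣ T ∣ ∸ ∣ ∅ {n} ∣) C t) * Y  ≡⟨ cong (λ s → ((∣ T ∣ ∸ s) C t) * Y) (∣⊥∣≡0 n) ⟩
      (∣ T ∣ C t) * Y                ∎
      where open ≤-Reasoning

  module _ {n k} {F : Family n} (uniform : Uniform k F) where

    degree-≤-1 : ∀ {S} → ∣ S ∣ ≡ k → degree F S ≤ 1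
    degree-≤-1 {S} ∣S∣≡k = count-unique≤1 (λ A → member? F A ×-dec S ⊆? A)
      λ (A∈F , S⊆A) (B∈F , S⊆B) → trans (sym (S≡ A∈F S⊆A)) (S≡ B∈F S⊆B)
      where
      S≡ : ∀ {A} → F A ≡ true → S ⊆ A → S ≡ A
      S≡ A∈F S⊆A = p⊆q⇒∣q∣≤∣p∣⇒p≡q S⊆A (≤-reflexive (trans (uniform _ A∈F) (sym ∣S∣≡k)))

    degree-≡0 : ∀ {S} → k < ∣ S ∣ → degree F S ≡ 0
    degree-≡0 {S} k<∣S∣ = count-none (λ A → member? F A ×-dec S ⊆? A)
      λ A (A∈F , S⊆A) → <⇒≱ k<∣S∣ (subst (_ ≤_) (uniform A A∈F) (p⊆q⇒∣p∣≤∣q∣ S⊆A))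

    ⊤-cover : IsTCover k F ⊤
    ⊤-cover A A∈F = ≤-reflexive (trans (sym (uniform A A∈F)) (cong ∣_∣ (sym (∩-identityˡ A))))

    degree-≤-C : ∀ {S} → ∣ S ∣ ≤ k → degree F S ≤ (n ∸ ∣ S ∣) C (k ∸ ∣ S ∣)
    degree-≤-C {S} ∣S∣≤k = begin
      degree F S
        ≤⟨ degree-≤-cover ⊤-cover (λ {S′} _ → degree-≤-1 {S′}) (k ∸ ∣ S ∣) {S} ⊆⊤ (m+[n∸m]≡n ∣S∣≤k) ⟩
      ((∣ ⊤ {n} ∣ ∸ ∣ S ∣) C (k ∸ ∣ S ∣)) * 1
        ≡⟨ cong (λ m → ((m ∸ ∣ S ∣) C (k ∸ ∣ S ∣)) * 1) (∣⊤∣≡n n) ⟩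
      ((n ∸ ∣ S ∣) C (k ∸ ∣ S ∣)) * 1
        ≡⟨ *-identityʳ _ ⟩
      (n ∸ ∣ S ∣) C (k ∸ ∣ S ∣) ∎
      where open ≤-Reasoning

  uncovered-member : ∀ {n t m} {G : Family n} → (∀ T → IsTCover t G T → m ≤ ∣ T ∣) →
                     ∀ {S} → ∣ S ∣ < m → ∃[ B ] G B ≡ true × ∣ S ∩ B ∣ < t
  uncovered-member {t = t} {G = G} τ≥ {S} ∣S∣<m
    with anySubset? (λ B → member? G B ×-dec ∣ S ∩ B ∣ <? t)
  ... | yes found = found
  ... | no  none  = contradiction (τ≥ S λ B B∈G → ≮⇒≥ λ j<t → none (B , B∈G , j<t)) (<⇒≱ ∣S∣<m)

  module _ {n ℓ t} {F G : Family n} (uniformG : Uniform ℓ G) (cross : CrossInt t F G) where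

    module _ {m W} (τ≥ : ∀ T → IsTCover t G T → m ≤ ∣ T ∣)
             (base : ∀ {S} → ∣ S ∣ ≡ m → degree F S ≤ W) where

      degree-≤-non-cover : ∀ r {S} → ∣ S ∣ + r ≡ m → degree F S ≤ suc (ℓ ∸ t) ^ r * W
      degree-≤-non-cover zero {S} ∣S∣+0≡m =
        subst (degree F S ≤_) (sym (*-identityˡ W)) (base {S} (trans (sym (+-identityʳ ∣ S ∣)) ∣S∣+0≡m))
      degree-≤-non-cover (suc r) {S} ∣S∣+1+r≡m
        with uncovered-member τ≥ {S} (subst (∣ S ∣ <_) ∣S∣+1+r≡m (m<m+n ∣ S ∣ z<s))
      ... | B , B∈G , j<t = *-cancelˡ-≤ (t ∸ j) (begin
        (t ∸ j) * degree F S          ≤⟨ degree-branch F S B meets grows ⟩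
        ∣ B ─ S ∣ * (x ^ r * W)        ≡⟨ cong (_* (x ^ r * W)) ∣B─S∣≡ℓ∸j ⟩
        (ℓ ∸ j) * (x ^ r * W)          ≤⟨ *-monoˡ-≤ (x ^ r * W) (ℓ∸j≤[t∸j]*[1+ℓ∸t] ℓ j<t) ⟩
        (t ∸ j) * x * (x ^ r * W)      ≡⟨ *-assoc (t ∸ j) x (x ^ r * W) ⟩
        (t ∸ j) * (x * (x ^ r * W))    ≡⟨ cong ((t ∸ j) *_) (*-assoc x (x ^ r) W) ⟨
        (t ∸ j) * (x ^ suc r * W)      ∎)
        where
        open ≤-Reasoning
        x = suc (ℓ ∸ t)
        j = ∣ S ∩ B ∣
        instance _ = >-nonZero (m<n⇒0<n∸m j<t)

        meets : ∀ {A} → F A ≡ true → S ⊆ A → j + (t ∸ j) ≤ ∣ A ∩ B ∣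
        meets {A} A∈F _ = subst (_≤ ∣ A ∩ B ∣) (sym (m+[n∸m]≡n (<⇒≤ j<t))) (cross A B A∈F B∈G)

        grows : ∀ {y} → y ∈ B → y ∉ S → degree F (S ∪ ⁅ y ⁆) ≤ x ^ r * W
        grows {y} _ y∉S = degree-≤-non-cover r {S ∪ ⁅ y ⁆}
          (trans (cong (_+ r) (x∉p⇒∣p∪⁅x⁆∣≡1+∣p∣ S y y∉S)) (trans (sym (+-suc ∣ S ∣ r)) ∣S∣+1+r≡m))

        ∣B─S∣≡ℓ∸j : ∣ B ─ S ∣ ≡ ℓ ∸ j
        ∣B─S∣≡ℓ∸j = trans (∣p─q∣≡∣p∣∸∣q∩p∣ B S) (cong (_∸ j) (uniformG B B∈G))

      module _ {T} (coverF : IsTCover t F T) where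

        card-≤-τ : t ≤ m → card F ≤ (∣ T ∣ C t) * (suc (ℓ ∸ t) ^ (m ∸ t) * W)
        card-≤-τ t≤m = card-≤-cover {T = T} coverF λ {S} _ ∣S∣≡t → degree-≤-non-cover (m ∸ t) {S}
          (trans (cong (_+ (m ∸ t)) ∣S∣≡t) (m+[n∸m]≡n t≤m))

        card-≤-τ≡t+1 : m ≡ t + 1 → card F ≤ suc (ℓ ∸ t) * (∣ T ∣ C t) * W
        card-≤-τ≡t+1 m≡t+1 = begin
          card F                            ≤⟨ card-≤-τ (subst (t ≤_) (sym m≡t+1) (m≤m+n t 1)) ⟩
          (∣ T ∣ C t) * (x ^ (m ∸ t) * W)   ≡⟨ cong (λ e → (∣ T ∣ C t) * (x ^ e * W)) m∸t≡1 ⟩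
          (∣ T ∣ C t) * (x ^ 1 * W)         ≡⟨ cong (λ y → (∣ T ∣ C t) * (y * W)) (*-identityʳ x) ⟩
          (∣ T ∣ C t) * (x * W)             ≡⟨ c*[a*w]≡a*c*w x (∣ T ∣ C t) W ⟩
          x * (∣ T ∣ C t) * W               ∎
          where
          open ≤-Reasoning
          x = suc (ℓ ∸ t)
          m∸t≡1 = trans (cong (_∸ t) m≡t+1) (m+n∸m≡n t 1)

        card-≤-τ≥t+2 : 1 ≤ t → t ≤ ℓ → t + 2 ≤ m →
                       card F ≤ ℓ ^ (m ∸ t ∸ 2) * suc (ℓ ∸ t) ^ 2 * (∣ T ∣ C t) * W
        card-≤-τ≥t+2 1≤t t≤ℓ t+2≤m = begin
          card F
            ≤⟨ card-≤-τ (≤-trans (m≤m+n t 2) t+2≤m) ⟩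
          (∣ T ∣ C t) * (x ^ (m ∸ t) * W)
            ≡⟨ cong (λ d → (∣ T ∣ C t) * (x ^ d * W)) (m∸n+n≡m 2≤m∸t) ⟨
          (∣ T ∣ C t) * (x ^ (e + 2) * W)
            ≡⟨ cong (λ y → (∣ T ∣ C t) * (y * W)) (^-distribˡ-+-* x e 2) ⟩
          (∣ T ∣ C t) * (x ^ e * x ^ 2 * W)
            ≤⟨ *-monoʳ-≤ (∣ T ∣ C t) (*-monoˡ-≤ W (*-monoˡ-≤ (x ^ 2) (^-monoˡ-≤ e x≤ℓ))) ⟩
          (∣ T ∣ C t) * (ℓ ^ e * x ^ 2 * W)
            ≡⟨ c*[a*w]≡a*c*w (ℓ ^ e * x ^ 2) (∣ T ∣ C t) W ⟩
          ℓ ^ e * x ^ 2 * (∣ T ∣ C t) * W ∎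
          where
          open ≤-Reasoning
          x = suc (ℓ ∸ t)
          e = m ∸ t ∸ 2

          2≤m∸t : 2 ≤ m ∸ t
          2≤m∸t = subst (_≤ m ∸ t) (m+n∸m≡n t 2) (∸-monoˡ-≤ t t+2≤m)

          x≤ℓ : x ≤ ℓ
          x≤ℓ = subst₂ _≤_ (+-comm (ℓ ∸ t) 1) (m∸n+n≡m t≤ℓ) (+-monoʳ-≤ (ℓ ∸ t) 1≤t)

    module _ {m} (τ≥ : ∀ T → IsTCover t G T → m ≤ ∣ T ∣) (t<m : t < m) (ℓ<t : ℓ < t) where

      no-members : ∀ A → F A ≢ true
      no-members A A∈F with uncovered-member τ≥ {∅} (subst (_< m) (sym (∣⊥∣≡0 n)) (<-≤-trans z<s t<m))
      ... | B , B∈G , _ = <⇒≱ ℓ<t (begin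
        t          ≤⟨ cross A B A∈F B∈G ⟩
        ∣ A ∩ B ∣  ≤⟨ ∣p∩q∣≤∣q∣ A B ⟩
        ∣ B ∣      ≡⟨ uniformG B B∈G ⟩
        ℓ          ∎)
        where open ≤-Reasoning

      card≡0 : card F ≡ 0
      card≡0 = trans (card≡count F) (count-none (member? F) no-members)

      ∅-cover : IsTCover t F ∅
      ∅-cover A A∈F = contradiction A∈F (no-members A)

open Counting
open import Data.Fin.Subset using (Subset; ∣_∣) renaming (⊥ to ∅)
open import Data.Fin.Subset.Properties using (∣p∣≤n; ∣⊥∣≡0)
open import Data.Integer using (+_; -_; _+_; _-_; _*_; _≤_; _^_; +≤+)
import Data.Integer.Properties as ℤ
open import Data.Nat using (ℕ; _∸_)
import Data.Nat as ℕ
open import Data.Nat.Combinatorics using (_C_)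
import Data.Nat.Properties as ℕ
open import Data.Product using (_×_; _,_)
open import Relation.Binary.PropositionalEquality
open import Relation.Nullary.Decidable using (yes; no)

+m-+n≡+[m∸n] : ∀ {m n} → n ℕ.≤ m → + m - + n ≡ + (m ∸ n)
+m-+n≡+[m∸n] {m} {n} n≤m = trans (ℤ.[+m]-[+n]≡m⊖n m n) (ℤ.⊖-≥ n≤m)

i-j-k≡i-[j+k] : ∀ i j k → i - j - k ≡ i - (j + k)
i-j-k≡i-[j+k] i j k = trans (ℤ.+-assoc i (- j) (- k)) (cong (λ z → i + z) (sym (ℤ.neg-distrib-+ j k)))

+ℓ-+t+1≡+[1+ℓ∸t] : ∀ {ℓ t} → t ℕ.≤ ℓ → + ℓ - + t + + 1 ≡ + ℕ.suc (ℓ ∸ t)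
+ℓ-+t+1≡+[1+ℓ∸t] {ℓ} {t} t≤ℓ =
  trans (cong (λ z → z + + 1) (+m-+n≡+[m∸n] t≤ℓ)) (cong +_ (ℕ.+-comm (ℓ ∸ t) 1))

pos-^ : ∀ a m → (+ a) ^ m ≡ + (a ℕ.^ m)
pos-^ a ℕ.zero    = refl
pos-^ a (ℕ.suc m) = trans (cong (+ a *_) (pos-^ a m)) (sym (ℤ.pos-* a (a ℕ.^ m)))

pos-*-*-≤ : ∀ {a} b c d → a ℕ.≤ b ℕ.* c ℕ.* d → + a ≤ + b * + c * + d
pos-*-*-≤ {a} b c d a≤bcd =
  subst (+ a ≤_) (trans (ℤ.pos-* (b ℕ.* c) d) (cong (_* + d) (ℤ.pos-* b c))) (+≤+ a≤bcd)

0Ck≡0 : ∀ {k} → 1 ℕ.≤ k → 0 C k ≡ 0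
0Ck≡0 (ℕ.s≤s ℕ.z≤n) = refl

degree-≤-binom : ∀ {n k} {F : Family n} → Uniform k F →
                 ∀ {S s} → ∣ S ∣ ≡ s → degree F S ℕ.≤ binom (+ n - + s) (+ k - + s)
degree-≤-binom {n} {k} {F} uniformF {S} refl with ∣ S ∣ ℕ.≤? k
... | yes ∣S∣≤k = subst (degree F S ℕ.≤_)
                    (sym (cong₂ binom (+m-+n≡+[m∸n] (∣p∣≤n S)) (+m-+n≡+[m∸n] ∣S∣≤k)))
                    (degree-≤-C uniformF {S} ∣S∣≤k)
... | no  ∣S∣≰k = ℕ.≤-trans (ℕ.≤-reflexive (degree-≡0 uniformF {S} (ℕ.≰⇒> ∣S∣≰k))) ℕ.z≤n

+card-≤-binom : ∀ {n k t} {F : Family n} → Uniform k F → ∀ {T} → IsTCover t F T →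
                + card F ≤ + binom (+ ∣ T ∣) (+ t) * + binom (+ n - + t) (+ k - + t)
+card-≤-binom {t = t} {F} uniformF {T} coverF =
  subst (+ card F ≤_) (ℤ.pos-* (∣ T ∣ C t) _)
    (+≤+ (card-≤-cover {T = T} coverF λ {S} _ → degree-≤-binom uniformF {S}))

module Bounds {n k ℓ t} {F G : Family n} (uniformF : Uniform k F) (uniformG : Uniform ℓ G)
              (cross : CrossInt t F G) {T : Subset n} (coverF : IsTCover t F T)
              (minimalF : ∀ T′ → IsTCover t F T′ → ∣ T ∣ ℕ.≤ ∣ T′ ∣) (1≤t : 1 ℕ.≤ t)
              {m} (τG≥ : ∀ T′ → IsTCover t G T′ → m ℕ.≤ ∣ T′ ∣) where

  -- The factor X may be ℓ - t + 1 < 0; when ℓ < t this is harmless because F is then empty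
  -- and τ_t(F) = 0, so both sides vanish.
  t≤ℓ-suffices : t ℕ.< m → ∀ X Y → (t ℕ.≤ ℓ → + card F ≤ X * + binom (+ ∣ T ∣) (+ t) * Y) →
                 + card F ≤ X * + binom (+ ∣ T ∣) (+ t) * Y
  t≤ℓ-suffices t<m X Y bound with t ℕ.≤? ℓ
  ... | yes t≤ℓ = bound t≤ℓ
  ... | no  t≰ℓ = subst₂ _≤_ (cong +_ (sym (card≡0 uniformG cross τG≥ t<m ℓ<t))) (sym rhs≡0) ℤ.≤-refl
    where
    ℓ<t = ℕ.≰⇒> t≰ℓ

    ∣T∣≡0 : ∣ T ∣ ≡ 0
    ∣T∣≡0 = ℕ.n≤0⇒n≡0 (subst (∣ T ∣ ℕ.≤_) (∣⊥∣≡0 n) (minimalF ∅ (∅-cover uniformG cross τG≥ t<m ℓ<t)))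

    rhs≡0 : X * + binom (+ ∣ T ∣) (+ t) * Y ≡ + 0
    rhs≡0 = begin
      X * + (∣ T ∣ C t) * Y  ≡⟨ cong (λ c → X * + (c C t) * Y) ∣T∣≡0 ⟩
      X * + (0 C t) * Y      ≡⟨ cong (λ c → X * + c * Y) (0Ck≡0 1≤t) ⟩
      X * + 0 * Y            ≡⟨ cong (_* Y) (ℤ.*-zeroʳ X) ⟩
      + 0                    ∎
      where open ≡-Reasoning

  +card-≤-τ≡t+1 : m ≡ t ℕ.+ 1 →
    + card F ≤ (+ ℓ - + t + + 1) * + binom (+ ∣ T ∣) (+ t) * + binom (+ n - + t - + 1) (+ k - + t - + 1)
  +card-≤-τ≡t+1 m≡t+1 =
    t≤ℓ-suffices (ℕ.≤-reflexive (trans (ℕ.+-comm 1 t) (sym m≡t+1)))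
      (+ ℓ - + t + + 1) (+ binom (+ n - + t - + 1) (+ k - + t - + 1)) λ t≤ℓ →
    subst₂ (λ X W → + card F ≤ X * + (∣ T ∣ C t) * + W)
      (sym (+ℓ-+t+1≡+[1+ℓ∸t] t≤ℓ)) (sym (cong₂ binom (-t-1≡-m (+ n)) (-t-1≡-m (+ k))))
      (pos-*-*-≤ (ℕ.suc (ℓ ∸ t)) (∣ T ∣ C t) (binom (+ n - + m) (+ k - + m))
        (card-≤-τ≡t+1 uniformG cross τG≥ (λ {S} → degree-≤-binom uniformF {S}) {T} coverF m≡t+1))
    where
    -t-1≡-m : ∀ i → i - + t - + 1 ≡ i - + m
    -t-1≡-m i = trans (i-j-k≡i-[j+k] i (+ t) (+ 1)) (cong (λ z → i - + z) (sym m≡t+1))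

  +card-≤-τ≥t+2 : t ℕ.+ 2 ℕ.≤ m →
    + card F ≤ (+ ℓ) ^ (m ∸ t ∸ 2) * (+ ℓ - + t + + 1) ^ 2 * + binom (+ ∣ T ∣) (+ t)
                 * + binom (+ n - + m) (+ k - + m)
  +card-≤-τ≥t+2 t+2≤m =
    t≤ℓ-suffices (ℕ.<-≤-trans (ℕ.m<m+n t ℕ.z<s) t+2≤m)
      ((+ ℓ) ^ (m ∸ t ∸ 2) * (+ ℓ - + t + + 1) ^ 2) (+ binom (+ n - + m) (+ k - + m)) λ t≤ℓ →
    subst (λ X → + card F ≤ X * + (∣ T ∣ C t) * + binom (+ n - + m) (+ k - + m)) (sym (coefficient t≤ℓ))
      (pos-*-*-≤ (ℓ ℕ.^ (m ∸ t ∸ 2) ℕ.* ℕ.suc (ℓ ∸ t) ℕ.^ 2) (∣ T ∣ C t) (binom (+ n - + m) (+ k - + m))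
        (card-≤-τ≥t+2 uniformG cross τG≥ (λ {S} → degree-≤-binom uniformF {S}) {T} coverF 1≤t t≤ℓ t+2≤m))
    where
    coefficient : t ℕ.≤ ℓ → (+ ℓ) ^ (m ∸ t ∸ 2) * (+ ℓ - + t + + 1) ^ 2
                            ≡ + (ℓ ℕ.^ (m ∸ t ∸ 2) ℕ.* ℕ.suc (ℓ ∸ t) ℕ.^ 2)
    coefficient t≤ℓ = trans
      (cong₂ _*_ (pos-^ ℓ (m ∸ t ∸ 2))
                 (trans (cong (_^ 2) (+ℓ-+t+1≡+[1+ℓ∸t] t≤ℓ)) (pos-^ (ℕ.suc (ℓ ∸ t)) 2)))
      (sym (ℤ.pos-* (ℓ ℕ.^ (m ∸ t ∸ 2)) _))

lemma3p5 : (n k ℓ t : ℕ) → + 1 ≤ + n → + 1 ≤ + k → + 1 ≤ + ℓ → + 1 ≤ + t →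
    + 2 * (+ k - + t + + 1) * (+ ℓ - + t + + 1) + + t + + 1 ≤ + n →
    (F G : Family n) → MaximalCrossInt k ℓ t F G →
    (mf mg : ℕ) → TauT≡ t F mf → TauT≡ t G mg →
    (+ card F ≤ + binom (+ mf) (+ t) * + binom (+ n - + t) (+ k - + t))
    × (+ mg ≡ + t + + 1 →
        + card F ≤ (+ ℓ - + t + + 1) * + binom (+ mf) (+ t)
                     * + binom (+ n - + t - + 1) (+ k - + t - + 1))
    × (+ t + + 2 ≤ + mg →
        + card F ≤ (+ ℓ) ^ (mg ∸ t ∸ 2) * (+ ℓ - + t + + 1) ^ 2 * + binom (+ mf) (+ t)
                     * + binom (+ n - + mg) (+ k - + mg))
lemma3p5 n k ℓ t _ _ _ +1≤+t _ F G (uniformF , uniformG , cross , _) mf mg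
         ((T , coverF , refl) , minimalF) (_ , τG≥) =
    +card-≤-binom uniformF {T} coverF
  , (λ mg≡t+1 → +card-≤-τ≡t+1 (ℤ.+-injective mg≡t+1))
  , (λ t+2≤mg → +card-≤-τ≥t+2 (ℤ.drop‿+≤+ t+2≤mg))
  where open Bounds uniformF uniformG cross {T} coverF minimalF (ℤ.drop‿+≤+ +1≤+t) τG≥
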